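{- Let $T$ be a finite rooted tree with root $r$ whose children are $r_1,\dots,r_k$, and let $T^1,\dots,T^k$ be the subtrees of $T$ rooted at $r_1,\dots,r_k$. For a finite rooted tree $S$ let $\bar S$ be the multigraph obtained by identifying all leaves of $S$ to a single sink vertex (keeping all edges) and adding one edge from the root of $S$ to the sink. Then \[ SP(\bar T)/\langle \hat r\rangle \;\simeq\; \Bigl(\bigoplus_{i=1}^k SP(\bar{T^i})\Bigr)\Big/\langle (\hat r_1,\dots,\hat r_k)\rangle, \] where $\langle\hat r\rangle$ is the cyclic subgroup of $SP(\bar T)$ generated by $\hat r$, and $\langle(\hat r_1,\dots,\hat r_k)\rangle$ is the cyclic subgroup of $\bigoplus_i SP(\bar{T^i})$ generated by $(\hat r_1,\dots,\hat r_k)$.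
   Context: For a finite multigraph $G$ (no loops) with sink $s$: a chip configuration is a function from non-sink vertices to $\mathbb{Z}_{\ge 0}$; a non-sink vertex $x$ with at least $\deg(x)$ chips may topple, sending one chip along each incident edge (chips reaching $s$ disappear); every configuration $u$ stabilizes to a unique stable configuration $u^\circ$. A stable $u$ is recurrent if $(u+v)^\circ=u$ for some nonzero configuration $v$. The sandpile group $SP(G)=\mathbb{Z}^{N-1}/\Delta\mathbb{Z}^{N-1}$ ($\Delta$ the reduced Laplacian with sink row/column removed, $\Delta_{ii}=-\deg(x_i)$, $\Delta_{ij}$ = number of edges between $x_i,x_j$) is identified with the set of recurrent configurations (each class has a unique recurrent representative) under the operation $(u,v)\mapsto (u+v)^\circ$. Let $e$ be the identity element (the recurrent representative of $0$). For a non-sink vertex $x$, $\delta_x$ denotes one chip at $x$ and $\hat x = (e+\delta_x)^\circ$ is its recurrent representative. -}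

module Defs where

open import Level using (0ℓ)
open import Algebra.Bundles using (AbelianGroup; RawGroup)
open import Algebra.Structures using (IsAbelianGroup)
open import Algebra.Morphism.Structures using (module GroupMorphisms)
import Algebra.Construct.Pointwise as Pointwise
open import Data.Nat using (ℕ; zero; suc; _+_)
open import Data.Integer using (ℤ; +_; -_)
import Data.Integer.Properties as ℤP
open import Data.Fin using (Fin; toℕ)
open import Data.List using (List; []; _∷_; _++_; filter; length)
open import Data.Maybe using (Maybe; just; nothing)
open import Data.Product using (Σ; _×_; _,_; proj₁; proj₂)
open import Data.Sum using (_⊎_)
open import Relation.Nullary using (Dec; yes; no; ¬_)
open import Relation.Nullary.Decidable using (_⊎-dec_; _×-dec_)
open import Relation.Binary.PropositionalEquality using (_≡_)
import Data.Nat.Properties as ℕP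
import Data.Fin.Properties as FinP
import Data.Maybe.Properties as MaybeP

-- Quotient of an abelian group by the subgroup generated by a predicate
-- S of "generators": the smallest congruence containing x ≈ y and
-- g ∼ ε for every generator g.

module _ (G : AbelianGroup 0ℓ 0ℓ) (S : AbelianGroup.Carrier G → Set) where
  open AbelianGroup G using (Carrier; _≈_; _∙_; ε; _⁻¹)
  private module G = AbelianGroup G

  data _∼_ : Carrier → Carrier → Set where
    incl   : ∀ {x y} → x ≈ y → x ∼ y
    gen    : ∀ {g} → S g → g ∼ ε
    ∼sym   : ∀ {x y} → x ∼ y → y ∼ x
    ∼trans : ∀ {x y z} → x ∼ y → y ∼ z → x ∼ z
    ∙cong  : ∀ {x y u v} → x ∼ y → u ∼ v → (x ∙ u) ∼ (y ∙ v)
    ⁻¹cong : ∀ {x y} → x ∼ y → (x ⁻¹) ∼ (y ⁻¹)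

  Quot : AbelianGroup 0ℓ 0ℓ
  Quot = record
    { Carrier = Carrier
    ; _≈_ = _∼_
    ; _∙_ = _∙_
    ; ε = ε
    ; _⁻¹ = _⁻¹
    ; isAbelianGroup = record
      { isGroup = record
        { isMonoid = record
          { isSemigroup = record
            { isMagma = record
              { isEquivalence = record
                { refl = incl G.refl ; sym = ∼sym ; trans = ∼trans }
              ; ∙-cong = ∙cong }
            ; assoc = λ x y z → incl (G.assoc x y z) }
          ; identity = (λ x → incl (G.identityˡ x)) , (λ x → incl (G.identityʳ x)) }
        ; inverse = (λ x → incl (G.inverseˡ x)) , (λ x → incl (G.inverseʳ x))
        ; ⁻¹-cong = ⁻¹cong }
      ; comm = λ x y → incl (G.comm x y) }
    }

_/⟨_⟩ : (G : AbelianGroup 0ℓ 0ℓ) → AbelianGroup.Carrier G → AbelianGroup 0ℓ 0ℓ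
G /⟨ g ⟩ = Quot G (λ x → x ≡ g)

ℤ^ : ℕ → AbelianGroup 0ℓ 0ℓ
ℤ^ n = Pointwise.abelianGroup (Fin n) ℤP.+-0-abelianGroup

⨁ : (k : ℕ) → (Fin k → AbelianGroup 0ℓ 0ℓ) → AbelianGroup 0ℓ 0ℓ
⨁ k G = record
  { Carrier = (i : Fin k) → Carrier (G i)
  ; _≈_ = λ x y → ∀ i → _≈_ (G i) (x i) (y i)
  ; _∙_ = λ x y i → _∙_ (G i) (x i) (y i)
  ; ε = λ i → ε (G i)
  ; _⁻¹ = λ x i → _⁻¹ (G i) (x i)
  ; isAbelianGroup = record
    { isGroup = record
      { isMonoid = record
        { isSemigroup = record
          { isMagma = record
            { isEquivalence = record
              { refl = λ i → refl (G i)
              ; sym = λ p i → sym (G i) (p i)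
              ; trans = λ p q i → trans (G i) (p i) (q i) }
            ; ∙-cong = λ p q i → ∙-cong (G i) (p i) (q i) }
          ; assoc = λ x y z i → assoc (G i) (x i) (y i) (z i) }
        ; identity = (λ x i → identityˡ (G i) (x i)) , (λ x i → identityʳ (G i) (x i)) }
      ; inverse = (λ x i → inverseˡ (G i) (x i)) , (λ x i → inverseʳ (G i) (x i))
      ; ⁻¹-cong = λ p i → ⁻¹-cong (G i) (p i) }
    ; comm = λ x y i → comm (G i) (x i) (y i) }
  }
  where open AbelianGroup

_≅_ : AbelianGroup 0ℓ 0ℓ → AbelianGroup 0ℓ 0ℓ → Set
G ≅ H = Σ (AbelianGroup.Carrier G → AbelianGroup.Carrier H)
          (GroupMorphisms.IsGroupIsomorphism (AbelianGroup.rawGroup G) (AbelianGroup.rawGroup H))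

-- Vertices are `Maybe ℕ`: `nothing` is the sink,
-- `just m` is the non-sink vertex x_m (for m < n).

Vtx : Set
Vtx = Maybe ℕ

record Multigraph : Set where
  constructor mkGraph
  field
    nV    : ℕ               -- number of non-sink vertices
    edges : List (Vtx × Vtx)
open Multigraph public

_≟V_ : (u v : Vtx) → Dec (u ≡ v)
_≟V_ = MaybeP.≡-dec ℕP._≟_

deg : List (Vtx × Vtx) → Vtx → ℕ
deg es x = length (filter (λ e → (proj₁ e ≟V x) ⊎-dec (proj₂ e ≟V x)) es)

nEdges : List (Vtx × Vtx) → Vtx → Vtx → ℕ
nEdges es x y = length (filter (λ e → ((proj₁ e ≟V x) ×-dec (proj₂ e ≟V y))
                                 ⊎-dec ((proj₁ e ≟V y) ×-dec (proj₂ e ≟V x))) es)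

Δ : (G : Multigraph) → Fin (nV G) → Fin (nV G) → ℤ
Δ G i j with i FinP.≟ j
... | yes _ = - (+ deg (edges G) (just (toℕ i)))
... | no  _ = + nEdges (edges G) (just (toℕ i)) (just (toℕ j))

SP : Multigraph → AbelianGroup 0ℓ 0ℓ
SP G = Quot (ℤ^ (nV G)) (λ v → Σ (Fin (nV G)) (λ j → ∀ i → v i ≡ Δ G i j))

-- the class of δ_x (one chip at x) in SP(G); a chip on the sink is 0.
δ : (G : Multigraph) → Vtx → AbelianGroup.Carrier (SP G)
δ G nothing  i = + 0
δ G (just m) i with toℕ i ℕP.≟ m
... | yes _ = + 1
... | no  _ = + 0

data Tree : Set where
  node : List Tree → Tree

mutual
  nInt : Tree → ℕ
  nInt (node [])       = 0
  nInt (node (t ∷ ts)) = suc (nIntL (t ∷ ts))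

  nIntL : List Tree → ℕ
  nIntL []       = 0
  nIntL (t ∷ ts) = nInt t + nIntL ts

-- Internal vertices are numbered in preorder starting from an offset.
lab : ℕ → Tree → Vtx
lab off (node [])      = nothing
lab off (node (_ ∷ _)) = just off

mutual
  edgesT : ℕ → Tree → List (Vtx × Vtx)
  edgesT off (node [])       = []
  edgesT off (node (t ∷ ts)) = edgesL (just off) (suc off) (t ∷ ts)

  edgesL : Vtx → ℕ → List Tree → List (Vtx × Vtx)
  edgesL p off []       = []
  edgesL p off (t ∷ ts) = ((p , lab off t) ∷ edgesT off t) ++ edgesL p (off + nInt t) ts

bar : Tree → Multigraph
bar S = mkGraph (nInt S) ((lab 0 S , nothing) ∷ edgesT 0 S)

rootHat : (S : Tree) → AbelianGroup.Carrier (SP (bar S))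
rootHat S = δ (bar S) (lab 0 S)

{-# OPTIONS --safe #-}

-- Number the internal vertices of T in preorder: the root r is x₀ and the subtree of the
-- i-th child occupies a block of consecutive vertices.  Apart from the root row and column,
-- the reduced Laplacian Δ of T̄ is then block diagonal with the reduced Laplacians Δᵢ of the
-- T̄ⁱ as blocks, because the edge r – rᵢ of T̄ takes the place of the edge rᵢ – sink of T̄ⁱ.
-- The root column is -(k+1) at r and r̂ᵢ on block i.  Hence restricting a vector to the
-- blocks sends every column of Δ to a column of some Δᵢ or to (r̂₁,…,r̂ₖ), and sends r̂ = δᵣ
-- to 0, so it induces a homomorphism SP(T̄)/⟨r̂⟩ → ⨁ SP(T̄ⁱ)/⟨(r̂ᵢ)ᵢ⟩.  Its inverse lays the
-- blocks side by side and puts 0 at the root.  This is well defined because it sends the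
-- j-th column of Δᵢ to a column of Δ minus r̂ᵢ(j)·δᵣ, and sends (r̂ᵢ)ᵢ to the root column
-- plus (k+1)·δᵣ.

module Submission where

open import Level using (0ℓ)
open import Algebra.Bundles using (AbelianGroup; Monoid)
open import Algebra.Morphism.Structures using (module GroupMorphisms)
import Algebra.Properties.Monoid.Sum
open import Data.Empty using (⊥-elim)
open import Data.Fin using (Fin; zero; suc; toℕ; _↑ˡ_; _↑ʳ_; splitAt)
open import Data.Fin.Properties
  using ( _≟_; suc-injective; toℕ-injective; toℕ<n; toℕ-↑ˡ; toℕ-↑ʳ
        ; splitAt-↑ˡ; splitAt-↑ʳ; splitAt⁻¹-↑ˡ; splitAt⁻¹-↑ʳ )
open import Data.Integer using (ℤ; +_; -_; -[1+_])
import Data.Integer as ℤ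
import Data.Integer.Properties as ℤP
open import Data.List using (List; []; _∷_; _++_; length; lookup; filter; map)
open import Data.List.Properties
  using (map-++; length-++; filter-++; filter-≐; filter-none; filter-accept; filter-reject)
open import Data.List.Relation.Unary.All using (All; []; _∷_)
import Data.List.Relation.Unary.All as All
open import Data.List.Relation.Unary.All.Properties using (++⁺)
open import Data.Maybe using (just; nothing)
import Data.Maybe as Maybe
open import Data.Maybe.Properties using (just-injective)
open import Data.Nat using (ℕ; zero; suc; _+_; _≤_; _<_; z<s)
import Data.Nat.Properties as ℕP
open import Data.Product using (Σ; _×_; _,_; proj₁; proj₂; uncurry)
import Data.Product as Product
open import Data.Sum using (_⊎_; inj₁; inj₂)
import Data.Sum as Sum
open import Function using (_∘_; _⇔_; mk⇔; Equivalence)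
open import Function.Definitions using (Injective)
open import Relation.Nullary using (¬_; yes; no)
open import Relation.Nullary.Decidable using (_⊎-dec_; _×-dec_)
open import Relation.Unary using (Pred; Decidable; ∁)
open import Relation.Binary.PropositionalEquality
  using (_≡_; _≢_; refl; sym; trans; cong; cong₂; subst; module ≡-Reasoning)

open import Defs

open GroupMorphisms using (IsGroupHomomorphism)
open AbelianGroup using (rawGroup)

module ℕΣ = Algebra.Properties.Monoid.Sum ℕP.+-0-monoid
module ℤΣ = Algebra.Properties.Monoid.Sum ℤP.+-0-monoid

module _ {a ℓ} (M : Monoid a ℓ) where
  open Monoid M using (Carrier; _≈_; ε)
  private module M = Monoid M
  open Algebra.Properties.Monoid.Sum M using (sum)

  sum-zero : ∀ {n} (f : Fin n → Carrier) → (∀ i → f i ≈ ε) → sum f ≈ ε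
  sum-zero {zero}  f f≈ε = M.refl
  sum-zero {suc n} f f≈ε =
    M.trans (M.∙-cong (f≈ε zero) (sum-zero (f ∘ suc) (f≈ε ∘ suc))) (M.identityˡ ε)

  sum-single : ∀ {n} (f : Fin n → Carrier) i → (∀ j → j ≢ i → f j ≈ ε) → sum f ≈ f i
  sum-single f zero    f≈ε =
    M.trans (M.∙-congˡ (sum-zero (f ∘ suc) (λ j → f≈ε (suc j) λ ()))) (M.identityʳ _)
  sum-single f (suc i) f≈ε =
    M.trans (M.∙-cong (f≈ε zero λ ()) (sum-single (f ∘ suc) i λ j j≢i → f≈ε (suc j) (j≢i ∘ suc-injective)))
      (M.identityˡ _)

module _ {G H : AbelianGroup 0ℓ 0ℓ} {S : AbelianGroup.Carrier G → Set}
         {f : AbelianGroup.Carrier G → AbelianGroup.Carrier H}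
         (f-hom : IsGroupHomomorphism (rawGroup G) (rawGroup H) f)
         (f-kills : ∀ {g} → S g → AbelianGroup._≈_ H (f g) (AbelianGroup.ε H)) where
  private module H = AbelianGroup H
  open IsGroupHomomorphism f-hom

  Quot-lift-cong : ∀ {x y} → _∼_ G S x y → f x H.≈ f y
  Quot-lift-cong (incl x≈y)   = ⟦⟧-cong x≈y
  Quot-lift-cong (gen s)      = H.trans (f-kills s) (H.sym ε-homo)
  Quot-lift-cong (∼sym p)     = H.sym (Quot-lift-cong p)
  Quot-lift-cong (∼trans p q) = H.trans (Quot-lift-cong p) (Quot-lift-cong q)
  Quot-lift-cong (∙cong {x} {y} {u} {v} p q) =
    H.trans (homo x u) (H.trans (H.∙-cong (Quot-lift-cong p) (Quot-lift-cong q)) (H.sym (homo y v)))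
  Quot-lift-cong (⁻¹cong {x} {y} p) =
    H.trans (⁻¹-homo x) (H.trans (H.⁻¹-cong (Quot-lift-cong p)) (H.sym (⁻¹-homo y)))

  Quot-lift : IsGroupHomomorphism (rawGroup (Quot G S)) (rawGroup H) f
  Quot-lift = record
    { isMonoidHomomorphism = record
      { isMagmaHomomorphism = record
        { isRelHomomorphism = record { cong = Quot-lift-cong }
        ; homo = homo }
      ; ε-homo = ε-homo }
    ; ⁻¹-homo = ⁻¹-homo }

module _ {n} {S T : (Fin n → ℤ) → Set} where
  private module H = AbelianGroup (Quot (Quot (ℤ^ n) S) T)

  scale-≈ε : ∀ {y} → y H.≈ H.ε → ∀ z → (λ a → z ℤ.* y a) H.≈ H.ε
  scale-≈ε {y} y≈ε (+ m)    = scale-ℕ m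
    where
      scale-ℕ : ∀ m → (λ a → + m ℤ.* y a) H.≈ H.ε
      scale-ℕ zero    = incl (incl (λ a → ℤP.*-zeroˡ (y a)))
      scale-ℕ (suc m) = H.trans (incl (incl (λ a → ℤP.suc-* (+ m) (y a))))
                                (H.trans (H.∙-cong y≈ε (scale-ℕ m)) (H.identityˡ H.ε))
  scale-≈ε {y} y≈ε -[1+ m ] =
    H.trans (incl (incl (λ a → sym (ℤP.neg-distribˡ-* (+ suc m) (y a)))))
            (H.trans (H.⁻¹-cong (scale-≈ε y≈ε (+ suc m))) (incl (incl (λ _ → refl))))

module _ {G H : AbelianGroup 0ℓ 0ℓ} {f : AbelianGroup.Carrier G → AbelianGroup.Carrier H}
         {g : AbelianGroup.Carrier H → AbelianGroup.Carrier G} where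
  private
    module G = AbelianGroup G
    module H = AbelianGroup H

  inverse⇒≅ : IsGroupHomomorphism (rawGroup G) (rawGroup H) f →
              (∀ {y y'} → y H.≈ y' → g y G.≈ g y') →
              (∀ y → f (g y) H.≈ y) → (∀ x → g (f x) G.≈ x) → G ≅ H
  inverse⇒≅ f-hom g-cong fg gf = f , record
    { isGroupMonomorphism = record
      { isGroupHomomorphism = f-hom
      ; injective = λ {x} {x'} fx≈fx' → G.trans (G.sym (gf x)) (G.trans (g-cong fx≈fx') (gf x')) }
    ; surjective = λ y → g y , λ z≈gy → H.trans (⟦⟧-cong z≈gy) (fg y) }
    where open IsGroupHomomorphism f-hom

trivial-≅ : {G H : AbelianGroup 0ℓ 0ℓ} →
            (∀ x y → AbelianGroup._≈_ G x y) → (∀ x y → AbelianGroup._≈_ H x y) → G ≅ H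
trivial-≅ {G} {H} G-trivial H-trivial =
  inverse⇒≅ {G = G} {H} {λ _ → H.ε} {λ _ → G.ε}
    const-hom (λ _ → G.refl) (λ _ → H-trivial _ _) (λ _ → G-trivial _ _)
  where
    module G = AbelianGroup G
    module H = AbelianGroup H
    const-hom : IsGroupHomomorphism (rawGroup G) (rawGroup H) (λ _ → H.ε)
    const-hom = record
      { isMonoidHomomorphism = record
        { isMagmaHomomorphism = record
          { isRelHomomorphism = record { cong = λ _ → H.refl }
          ; homo = λ _ _ → H-trivial _ _ }
        ; ε-homo = H.refl }
      ; ⁻¹-homo = λ _ → H-trivial _ _ }

module _ {A : Set} {P : Pred A 0ℓ} (P? : Decidable P) where

  length-filter-++ : ∀ xs ys →
    length (filter P? (xs ++ ys)) ≡ length (filter P? xs) + length (filter P? ys)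
  length-filter-++ xs ys = trans (cong length (filter-++ P? xs ys)) (length-++ (filter P? xs))

  length-filter-none : ∀ {xs} → All (∁ P) xs → length (filter P? xs) ≡ 0
  length-filter-none ¬Pxs = cong length (filter-none P? ¬Pxs)

  length-filter-head : ∀ {x y xs} → P x ⇔ P y → length (filter P? (x ∷ xs)) ≡ length (filter P? (y ∷ xs))
  length-filter-head {x} {y} Px⇔Py with P? x | P? y
  ... | yes _  | yes _  = refl
  ... | no _   | no _   = refl
  ... | yes Px | no ¬Py = ⊥-elim (¬Py (Equivalence.to Px⇔Py Px))
  ... | no ¬Px | yes Py = ⊥-elim (¬Px (Equivalence.from Px⇔Py Py))

  length-filter-map : ∀ {B : Set} {Q : Pred B 0ℓ} (Q? : Decidable Q) (f : B → A) →
                      (∀ x → P (f x) ⇔ Q x) → ∀ xs → length (filter P? (map f xs)) ≡ length (filter Q? xs)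
  length-filter-map Q? f P∘f⇔Q []       = refl
  length-filter-map Q? f P∘f⇔Q (x ∷ xs) with P? (f x) | Q? x
  ... | yes _   | yes _  = cong suc (length-filter-map Q? f P∘f⇔Q xs)
  ... | no _    | no _   = length-filter-map Q? f P∘f⇔Q xs
  ... | yes Pfx | no ¬Qx = ⊥-elim (¬Qx (Equivalence.to (P∘f⇔Q x) Pfx))
  ... | no ¬Pfx | yes Qx = ⊥-elim (¬Pfx (Equivalence.from (P∘f⇔Q x) Qx))

Edge : Set
Edge = Vtx × Vtx

Incident : Vtx → Pred Edge 0ℓ
Incident x e = proj₁ e ≡ x ⊎ proj₂ e ≡ x

Joins : Vtx → Vtx → Pred Edge 0ℓ
Joins x y e = (proj₁ e ≡ x × proj₂ e ≡ y) ⊎ (proj₁ e ≡ y × proj₂ e ≡ x)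

Avoids : Vtx → Pred Edge 0ℓ
Avoids x = ∁ (Incident x)

incident? : ∀ x → Decidable (Incident x)
incident? x e = (proj₁ e ≟V x) ⊎-dec (proj₂ e ≟V x)

joins? : ∀ x y → Decidable (Joins x y)
joins? x y e = ((proj₁ e ≟V x) ×-dec (proj₂ e ≟V y)) ⊎-dec ((proj₁ e ≟V y) ×-dec (proj₂ e ≟V x))

avoids : ∀ {x a b} → a ≢ x → b ≢ x → Avoids x (a , b)
avoids a≢x b≢x = Sum.[ a≢x , b≢x ]

Joins⇒Incidentˡ : ∀ {x y e} → Joins x y e → Incident x e
Joins⇒Incidentˡ = Sum.map proj₁ proj₂

Joins⇒Incidentʳ : ∀ {x y e} → Joins x y e → Incident y e
Joins⇒Incidentʳ = Sum.[ inj₂ ∘ proj₂ , inj₁ ∘ proj₁ ]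

deg-avoid : ∀ {x es} → All (Avoids x) es → deg es x ≡ 0
deg-avoid = length-filter-none (incident? _)

nEdges-avoidˡ : ∀ {x es} y → All (Avoids x) es → nEdges es x y ≡ 0
nEdges-avoidˡ y = length-filter-none (joins? _ y) ∘ All.map (_∘ Joins⇒Incidentˡ)

nEdges-avoidʳ : ∀ x {y es} → All (Avoids y) es → nEdges es x y ≡ 0
nEdges-avoidʳ x = length-filter-none (joins? x _) ∘ All.map (_∘ Joins⇒Incidentʳ)

nEdges-comm : ∀ es x y → nEdges es x y ≡ nEdges es y x
nEdges-comm es x y = cong length (filter-≐ (joins? x y) (joins? y x) (Sum.swap , Sum.swap) es)

module _ {ρ : Vtx → Vtx} (ρ-injective : Injective _≡_ _≡_ ρ) where

  deg-rename : ∀ es x → deg (map (Product.map ρ ρ) es) (ρ x) ≡ deg es x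
  deg-rename es x = length-filter-map (incident? (ρ x)) (incident? x) _
    (λ _ → mk⇔ (Sum.map ρ-injective ρ-injective) (Sum.map (cong ρ) (cong ρ))) es

  nEdges-rename : ∀ es x y → nEdges (map (Product.map ρ ρ) es) (ρ x) (ρ y) ≡ nEdges es x y
  nEdges-rename es x y = length-filter-map (joins? (ρ x) (ρ y)) (joins? x y) _
    (λ _ → mk⇔ (Sum.map (Product.map ρ-injective ρ-injective) (Product.map ρ-injective ρ-injective))
               (Sum.map (Product.map (cong ρ) (cong ρ)) (Product.map (cong ρ) (cong ρ)))) es

shift : ℕ → Vtx → Vtx
shift d = Maybe.map (λ m → d + m)

shift-injective : ∀ d → Injective _≡_ _≡_ (shift d)
shift-injective d {nothing} {nothing} _  = refl
shift-injective d {just m}  {just n}  eq = cong just (ℕP.+-cancelˡ-≡ d m n (just-injective eq))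

shiftEdge : ℕ → Edge → Edge
shiftEdge d = Product.map (shift d) (shift d)

lab-shift : ∀ d o t → lab (d + o) t ≡ shift d (lab o t)
lab-shift d o (node [])      = refl
lab-shift d o (node (_ ∷ _)) = refl

mutual
  edgesT-shift : ∀ d o t → edgesT (d + o) t ≡ map (shiftEdge d) (edgesT o t)
  edgesT-shift d o (node [])       = refl
  edgesT-shift d o (node (t ∷ ts)) = begin
    edgesL (just (d + o)) (suc (d + o)) (t ∷ ts)
      ≡⟨ cong (λ o' → edgesL (just (d + o)) o' (t ∷ ts)) (ℕP.+-suc d o) ⟨
    edgesL (just (d + o)) (d + suc o) (t ∷ ts)
      ≡⟨ edgesL-shift d (just o) (suc o) (t ∷ ts) ⟩
    map (shiftEdge d) (edgesL (just o) (suc o) (t ∷ ts)) ∎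
    where open ≡-Reasoning

  edgesL-shift : ∀ d p o ts → edgesL (shift d p) (d + o) ts ≡ map (shiftEdge d) (edgesL p o ts)
  edgesL-shift d p o []       = refl
  edgesL-shift d p o (t ∷ ts) = begin
    ((shift d p , lab (d + o) t) ∷ edgesT (d + o) t) ++ edgesL (shift d p) (d + o + nInt t) ts
      ≡⟨ cong₂ (λ r es → ((shift d p , r) ∷ es) ++ edgesL (shift d p) (d + o + nInt t) ts)
               (lab-shift d o t) (edgesT-shift d o t) ⟩
    map (shiftEdge d) child ++ edgesL (shift d p) (d + o + nInt t) ts
      ≡⟨ cong (λ o' → map (shiftEdge d) child ++ edgesL (shift d p) o' ts) (ℕP.+-assoc d o (nInt t)) ⟩
    map (shiftEdge d) child ++ edgesL (shift d p) (d + (o + nInt t)) ts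
      ≡⟨ cong (map (shiftEdge d) child ++_) (edgesL-shift d p (o + nInt t) ts) ⟩
    map (shiftEdge d) child ++ map (shiftEdge d) (edgesL p (o + nInt t) ts)
      ≡⟨ map-++ (shiftEdge d) child _ ⟨
    map (shiftEdge d) (child ++ edgesL p (o + nInt t) ts) ∎
    where
      open ≡-Reasoning
      child = (p , lab o t) ∷ edgesT o t

bar-edges-shift : ∀ o t → (lab o t , nothing) ∷ edgesT o t ≡ map (shiftEdge o) (edges (bar t))
bar-edges-shift o t =
  subst (λ o' → (lab o' t , nothing) ∷ edgesT o' t ≡ map (shiftEdge o) (edges (bar t))) (ℕP.+-identityʳ o)
        (cong₂ (λ r es → (r , nothing) ∷ es) (lab-shift o 0 t) (edgesT-shift o 0 t))

infix 4 _∉[_,_⟩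
_∉[_,_⟩ : ℕ → ℕ → ℕ → Set
v ∉[ lo , hi ⟩ = v < lo ⊎ hi ≤ v

∉-mono : ∀ {v lo hi lo' hi'} → lo ≤ lo' → hi' ≤ hi → v ∉[ lo , hi ⟩ → v ∉[ lo' , hi' ⟩
∉-mono lo≤lo' hi'≤hi (inj₁ v<lo) = inj₁ (ℕP.<-≤-trans v<lo lo≤lo')
∉-mono lo≤lo' hi'≤hi (inj₂ hi≤v) = inj₂ (ℕP.≤-trans hi'≤hi hi≤v)

∉⇒≢-lower : ∀ {v lo hi} → lo < hi → v ∉[ lo , hi ⟩ → just lo ≢ just v
∉⇒≢-lower lo<hi (inj₁ v<lo) refl = ℕP.<-irrefl refl v<lo
∉⇒≢-lower lo<hi (inj₂ hi≤v) refl = ℕP.<-irrefl refl (ℕP.<-≤-trans lo<hi hi≤v)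

lab-avoid : ∀ {v o} t → v ∉[ o , o + nInt t ⟩ → lab o t ≢ just v
lab-avoid         (node [])      out ()
lab-avoid {o = o} (node (_ ∷ _)) out = ∉⇒≢-lower (ℕP.m<m+n o z<s) out

mutual
  edgesT-avoid : ∀ {v o} t → v ∉[ o , o + nInt t ⟩ → All (Avoids (just v)) (edgesT o t)
  edgesT-avoid         (node [])       out = []
  edgesT-avoid {o = o} (node (t ∷ ts)) out =
    edgesL-avoid (t ∷ ts) (∉⇒≢-lower (ℕP.m<m+n o z<s) out)
      (∉-mono (ℕP.n≤1+n o) (ℕP.≤-reflexive (sym (ℕP.+-suc o (nIntL (t ∷ ts))))) out)

  edgesL-avoid : ∀ {v p o} ts → p ≢ just v → v ∉[ o , o + nIntL ts ⟩ →
                 All (Avoids (just v)) (edgesL p o ts)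
  edgesL-avoid         []       p≢v out = []
  edgesL-avoid {o = o} (t ∷ ts) p≢v out =
    ++⁺ (avoids p≢v (lab-avoid t out-t) ∷ edgesT-avoid t out-t) (edgesL-avoid ts p≢v out-ts)
    where
      out-t  = ∉-mono ℕP.≤-refl (ℕP.+-monoʳ-≤ o (ℕP.m≤m+n (nInt t) (nIntL ts))) out
      out-ts = ∉-mono (ℕP.m≤m+n o (nInt t)) (ℕP.≤-reflexive (ℕP.+-assoc o (nInt t) (nIntL ts))) out

childEdges : Vtx → ℕ → Tree → List Edge
childEdges p o t = (p , lab o t) ∷ edgesT o t

module _ {o : ℕ} (0<o : 0 < o) where

  private
    root≢ : ∀ {m} → just 0 ≢ just (o + m)
    root≢ eq = ℕP.<-irrefl (just-injective eq) (ℕP.<-≤-trans 0<o (ℕP.m≤m+n o _))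

    edgesT-avoid-root : ∀ t → All (Avoids (just 0)) (edgesT o t)
    edgesT-avoid-root t = edgesT-avoid t (inj₁ 0<o)

  child-deg-root : ∀ t → deg (childEdges (just 0) o t) (just 0) ≡ 1
  child-deg-root t = begin
    deg (childEdges (just 0) o t) (just 0)
      ≡⟨ cong length (filter-accept (incident? (just 0)) {just 0 , lab o t} {edgesT o t} (inj₁ refl)) ⟩
    suc (deg (edgesT o t) (just 0))
      ≡⟨ cong suc (deg-avoid {es = edgesT o t} (edgesT-avoid-root t)) ⟩
    1 ∎
    where open ≡-Reasoning

  child-deg : ∀ t m → deg (childEdges (just 0) o t) (just (o + m)) ≡ deg (edges (bar t)) (just m)
  child-deg t m = begin
    deg ((just 0 , lab o t) ∷ edgesT o t) (just (o + m))
      ≡⟨ length-filter-head (incident? (just (o + m))) {just 0 , lab o t} {lab o t , nothing} {edgesT o t}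
           (mk⇔ Sum.[ ⊥-elim ∘ root≢ , inj₁ ] Sum.[ inj₂ , (λ ()) ]) ⟩
    deg ((lab o t , nothing) ∷ edgesT o t) (just (o + m))
      ≡⟨ cong (λ es → deg es (just (o + m))) (bar-edges-shift o t) ⟩
    deg (map (shiftEdge o) (edges (bar t))) (shift o (just m))
      ≡⟨ deg-rename (shift-injective o) (edges (bar t)) (just m) ⟩
    deg (edges (bar t)) (just m) ∎
    where open ≡-Reasoning

  child-nEdges : ∀ t m m' →
    nEdges (childEdges (just 0) o t) (just (o + m)) (just (o + m')) ≡ nEdges (edges (bar t)) (just m) (just m')
  child-nEdges t m m' = begin
    nEdges ((just 0 , lab o t) ∷ edgesT o t) (just (o + m)) (just (o + m'))
      ≡⟨ length-filter-head (joins? (just (o + m)) (just (o + m')))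
           {just 0 , lab o t} {lab o t , nothing} {edgesT o t}
           (mk⇔ (⊥-elim ∘ Sum.[ root≢ ∘ proj₁ , root≢ ∘ proj₁ ])
                λ { (inj₁ (_ , ())) ; (inj₂ (_ , ())) }) ⟩
    nEdges ((lab o t , nothing) ∷ edgesT o t) (just (o + m)) (just (o + m'))
      ≡⟨ cong (λ es → nEdges es (just (o + m)) (just (o + m'))) (bar-edges-shift o t) ⟩
    nEdges (map (shiftEdge o) (edges (bar t))) (shift o (just m)) (shift o (just m'))
      ≡⟨ nEdges-rename (shift-injective o) (edges (bar t)) (just m) (just m') ⟩
    nEdges (edges (bar t)) (just m) (just m') ∎
    where open ≡-Reasoning

  child-nEdges-root : ∀ t (j : Fin (nInt t)) →
    + nEdges (childEdges (just 0) o t) (just (o + toℕ j)) (just 0) ≡ rootHat t j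
  child-nEdges-root t@(node (_ ∷ _)) zero = cong +_ (begin
    nEdges ((just 0 , just o) ∷ edgesT o t) (just (o + 0)) (just 0)
      ≡⟨ cong length (filter-accept (joins? _ _) {xs = edgesT o t}
           (inj₂ (refl , cong just (sym (ℕP.+-identityʳ o))))) ⟩
    suc (nEdges (edgesT o t) (just (o + 0)) (just 0))
      ≡⟨ cong suc (nEdges-avoidʳ (just (o + 0)) (edgesT-avoid-root t)) ⟩
    1 ∎)
    where open ≡-Reasoning
  child-nEdges-root t@(node (_ ∷ _)) (suc j) = cong +_ (begin
    nEdges ((just 0 , just o) ∷ edgesT o t) (just (o + suc (toℕ j))) (just 0)
      ≡⟨ cong length (filter-reject (joins? _ _) {xs = edgesT o t}
           λ { (inj₁ (eq , _)) → root≢ eq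
             ; (inj₂ (_ , eq)) → ℕP.m+1+n≢m o (sym (just-injective eq)) }) ⟩
    nEdges (edgesT o t) (just (o + suc (toℕ j))) (just 0)
      ≡⟨ nEdges-avoidʳ (just (o + suc (toℕ j))) (edgesT-avoid-root t) ⟩
    0 ∎)
    where open ≡-Reasoning

child-avoid : ∀ {v o} t → 0 ≢ v → v ∉[ o , o + nInt t ⟩ →
              All (Avoids (just v)) (childEdges (just 0) o t)
child-avoid t 0≢v out = avoids (0≢v ∘ just-injective) (lab-avoid t out) ∷ edgesT-avoid t out

subtreeStart : ℕ → (ts : List Tree) → Fin (length ts) → ℕ
subtreeStart o (t ∷ ts) zero    = o
subtreeStart o (t ∷ ts) (suc i) = subtreeStart (o + nInt t) ts i

subtreeStart-≥ : ∀ o ts i → o ≤ subtreeStart o ts i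
subtreeStart-≥ o (t ∷ ts) zero    = ℕP.≤-refl
subtreeStart-≥ o (t ∷ ts) (suc i) = ℕP.≤-trans (ℕP.m≤m+n o (nInt t)) (subtreeStart-≥ (o + nInt t) ts i)

subtreeStart-disjoint : ∀ o ts {i i' m} → i ≢ i' → m < nInt (lookup ts i) →
  subtreeStart o ts i + m ∉[ subtreeStart o ts i' , subtreeStart o ts i' + nInt (lookup ts i') ⟩
subtreeStart-disjoint o (t ∷ ts) {zero}  {zero}   i≢i' m<n = ⊥-elim (i≢i' refl)
subtreeStart-disjoint o (t ∷ ts) {zero}  {suc i'} i≢i' m<n =
  inj₁ (ℕP.<-≤-trans (ℕP.+-monoʳ-< o m<n) (subtreeStart-≥ (o + nInt t) ts i'))
subtreeStart-disjoint o (t ∷ ts) {suc i} {zero}   i≢i' m<n =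
  inj₂ (ℕP.≤-trans (subtreeStart-≥ (o + nInt t) ts i) (ℕP.m≤m+n _ _))
subtreeStart-disjoint o (t ∷ ts) {suc i} {suc i'} i≢i' m<n =
  subtreeStart-disjoint (o + nInt t) ts (i≢i' ∘ cong suc) m<n

length-filter-edgesL : ∀ {P : Pred Edge 0ℓ} (P? : Decidable P) p o ts →
  length (filter P? (edgesL p o ts))
    ≡ ℕΣ.sum (λ i → length (filter P? (childEdges p (subtreeStart o ts i) (lookup ts i))))
length-filter-edgesL P? p o []       = refl
length-filter-edgesL P? p o (t ∷ ts) =
  trans (length-filter-++ P? (childEdges p o t) (edgesL p (o + nInt t) ts))
        (cong (_+_ (length (filter P? (childEdges p o t)))) (length-filter-edgesL P? p (o + nInt t) ts))

block : (ts : List Tree) (i : Fin (length ts)) → Fin (nInt (lookup ts i)) → Fin (nIntL ts)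
block (t ∷ ts) zero    j = j ↑ˡ nIntL ts
block (t ∷ ts) (suc i) j = nInt t ↑ʳ block ts i j

locate : (ts : List Tree) → Fin (nIntL ts) → Σ (Fin (length ts)) (λ i → Fin (nInt (lookup ts i)))
locate (t ∷ ts) b with splitAt (nInt t) b
... | inj₁ j  = zero , j
... | inj₂ b' = Product.map suc (λ j → j) (locate ts b')

locate-block : ∀ ts i j → locate ts (block ts i j) ≡ (i , j)
locate-block (t ∷ ts) zero    j rewrite splitAt-↑ˡ (nInt t) j (nIntL ts) = refl
locate-block (t ∷ ts) (suc i) j
  rewrite splitAt-↑ʳ (nInt t) (nIntL ts) (block ts i j) | locate-block ts i j = refl

block-locate : ∀ ts b → uncurry (block ts) (locate ts b) ≡ b
block-locate (t ∷ ts) b with splitAt (nInt t) b in eq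
... | inj₁ j  = splitAt⁻¹-↑ˡ eq
... | inj₂ b' = trans (cong (nInt t ↑ʳ_) (block-locate ts b')) (splitAt⁻¹-↑ʳ eq)

toℕ-block : ∀ o ts i j → o + toℕ (block ts i j) ≡ subtreeStart o ts i + toℕ j
toℕ-block o (t ∷ ts) zero    j = cong (_+_ o) (toℕ-↑ˡ j (nIntL ts))
toℕ-block o (t ∷ ts) (suc i) j = begin
  o + toℕ (nInt t ↑ʳ block ts i j)   ≡⟨ cong (_+_ o) (toℕ-↑ʳ (nInt t) (block ts i j)) ⟩
  o + (nInt t + toℕ (block ts i j))  ≡⟨ ℕP.+-assoc o (nInt t) _ ⟨
  o + nInt t + toℕ (block ts i j)    ≡⟨ toℕ-block (o + nInt t) ts i j ⟩
  subtreeStart (o + nInt t) ts i + toℕ j ∎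
  where open ≡-Reasoning

Δ-diag : ∀ G {a b} → a ≡ b → Δ G a b ≡ - (+ deg (edges G) (just (toℕ a)))
Δ-diag G {a} {b} a≡b with a ≟ b
... | yes _  = refl
... | no a≢b = ⊥-elim (a≢b a≡b)

Δ-offdiag : ∀ G {a b} → a ≢ b → Δ G a b ≡ + nEdges (edges G) (just (toℕ a)) (just (toℕ b))
Δ-offdiag G {a} {b} a≢b with a ≟ b
... | yes a≡b = ⊥-elim (a≢b a≡b)
... | no _    = refl

Δ-sym : ∀ G a b → Δ G a b ≡ Δ G b a
Δ-sym G a b with a ≟ b
... | yes refl = sym (Δ-diag G refl)
... | no a≢b   = begin
  + nEdges (edges G) (just (toℕ a)) (just (toℕ b)) ≡⟨ cong +_ (nEdges-comm (edges G) _ _) ⟩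
  + nEdges (edges G) (just (toℕ b)) (just (toℕ a)) ≡⟨ Δ-offdiag G (a≢b ∘ sym) ⟨
  Δ G b a ∎
  where open ≡-Reasoning

-- This is bar (node ts) whenever ts is non-empty; for ts = [] the root is itself a leaf.
barNode : List Tree → Multigraph
barNode ts = mkGraph (suc (nIntL ts)) ((just 0 , nothing) ∷ edgesL (just 0) 1 ts)

module BarNode (ts : List Tree) where

  k : ℕ
  k = length ts

  child : Fin k → Tree
  child = lookup ts

  G : Multigraph
  G = barNode ts

  start : Fin k → ℕ
  start = subtreeStart 1 ts

  vtx : (i : Fin k) → Fin (nInt (child i)) → Fin (nV G)
  vtx i j = suc (block ts i j)

  toℕ-vtx : ∀ i j → toℕ (vtx i j) ≡ start i + toℕ j
  toℕ-vtx = toℕ-block 1 ts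

  vtx-locate : ∀ b → uncurry vtx (locate ts b) ≡ suc b
  vtx-locate b = cong suc (block-locate ts b)

  vtx-injectiveˡ : ∀ {i i' j j'} → vtx i j ≡ vtx i' j' → i ≡ i'
  vtx-injectiveˡ {i} {i'} {j} {j'} eq = begin
    i                                  ≡⟨ cong proj₁ (locate-block ts i j) ⟨
    proj₁ (locate ts (block ts i j))   ≡⟨ cong (proj₁ ∘ locate ts) (suc-injective eq) ⟩
    proj₁ (locate ts (block ts i' j')) ≡⟨ cong proj₁ (locate-block ts i' j') ⟩
    i'                                 ∎
    where open ≡-Reasoning

  vtx-injectiveʳ : ∀ {i j j'} → vtx i j ≡ vtx i j' → j ≡ j'
  vtx-injectiveʳ {i} {j} {j'} eq = toℕ-injective (ℕP.+-cancelˡ-≡ (start i) _ _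
    (trans (sym (toℕ-vtx i j)) (trans (cong toℕ eq) (toℕ-vtx i j'))))

  0<start : ∀ i → 0 < start i
  0<start = subtreeStart-≥ 1 ts

  0≢vtx : ∀ i (j : Fin (nInt (child i))) → 0 ≢ start i + toℕ j
  0≢vtx i j 0≡v = ℕP.<-irrefl 0≡v (ℕP.<-≤-trans (0<start i) (ℕP.m≤m+n (start i) (toℕ j)))

  sinkEdge-avoid : ∀ i (j : Fin (nInt (child i))) → Avoids (just (start i + toℕ j)) (just 0 , nothing)
  sinkEdge-avoid i j = Sum.[ 0≢vtx i j ∘ just-injective , (λ ()) ]

  child-avoid-vtx : ∀ {i i'} → i' ≢ i → (j : Fin (nInt (child i))) →
    All (Avoids (just (start i + toℕ j))) (childEdges (just 0) (start i') (child i'))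
  child-avoid-vtx {i} {i'} i'≢i j =
    child-avoid (child i') (0≢vtx i j) (subtreeStart-disjoint 1 ts (i'≢i ∘ sym) (toℕ<n j))

  length-filter-edges : ∀ {P : Pred Edge 0ℓ} (P? : Decidable P) → ¬ P (just 0 , nothing) →
    length (filter P? (edges G)) ≡ ℕΣ.sum (λ i → length (filter P? (childEdges (just 0) (start i) (child i))))
  length-filter-edges P? ¬P-sinkEdge =
    trans (cong length (filter-reject P? ¬P-sinkEdge)) (length-filter-edgesL P? (just 0) 1 ts)

  length-filter-vtx : ∀ {P : Pred Edge 0ℓ} (P? : Decidable P) i (j : Fin (nInt (child i))) →
    (∀ {e} → P e → Incident (just (start i + toℕ j)) e) →
    length (filter P? (edges G)) ≡ length (filter P? (childEdges (just 0) (start i) (child i)))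
  length-filter-vtx P? i j P⇒incident =
    trans (length-filter-edges P? (sinkEdge-avoid i j ∘ P⇒incident))
          (sum-single ℕP.+-0-monoid _ i λ i' i'≢i →
             length-filter-none P? (All.map (_∘ P⇒incident) (child-avoid-vtx i'≢i j)))

  Δ-root-root : Δ G zero zero ≡ - (+ suc k)
  Δ-root-root = trans (Δ-diag G {zero} refl) (cong (λ n → - (+ n)) (begin
    deg (edges G) (just 0)
      ≡⟨ cong length (filter-accept (incident? (just 0)) {just 0 , nothing} {edgesL (just 0) 1 ts} (inj₁ refl)) ⟩
    suc (deg (edgesL (just 0) 1 ts) (just 0))
      ≡⟨ cong suc (length-filter-edgesL (incident? (just 0)) (just 0) 1 ts) ⟩
    suc (ℕΣ.sum (λ i → deg (childEdges (just 0) (start i) (child i)) (just 0)))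
      ≡⟨ cong suc (ℕΣ.sum-cong-≗ (λ i → child-deg-root (0<start i) (child i))) ⟩
    suc (ℕΣ.sum {k} (λ _ → 1))
      ≡⟨ cong suc (sum-ones k) ⟩
    suc k ∎))
    where
      open ≡-Reasoning
      sum-ones : ∀ n → ℕΣ.sum {n} (λ _ → 1) ≡ n
      sum-ones zero    = refl
      sum-ones (suc n) = cong suc (sum-ones n)

  Δ-vtx-root : ∀ i j → Δ G (vtx i j) zero ≡ rootHat (child i) j
  Δ-vtx-root i j = begin
    Δ G (vtx i j) zero
      ≡⟨ Δ-offdiag G {vtx i j} {zero} (λ ()) ⟩
    + nEdges (edges G) (just (toℕ (vtx i j))) (just 0)
      ≡⟨ cong (λ v → + nEdges (edges G) (just v) (just 0)) (toℕ-vtx i j) ⟩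
    + nEdges (edges G) (just (start i + toℕ j)) (just 0)
      ≡⟨ cong +_ (length-filter-vtx (joins? _ _) i j Joins⇒Incidentˡ) ⟩
    + nEdges (childEdges (just 0) (start i) (child i)) (just (start i + toℕ j)) (just 0)
      ≡⟨ child-nEdges-root (0<start i) (child i) j ⟩
    rootHat (child i) j ∎
    where open ≡-Reasoning

  Δ-root-vtx : ∀ i j → Δ G zero (vtx i j) ≡ rootHat (child i) j
  Δ-root-vtx i j = trans (Δ-sym G zero (vtx i j)) (Δ-vtx-root i j)

  -- The with also decides j ≟ j' inside the right-hand side Δ (bar (child i)) j j'.
  Δ-vtx-vtx : ∀ i j j' → Δ G (vtx i j) (vtx i j') ≡ Δ (bar (child i)) j j'
  Δ-vtx-vtx i j j' with j ≟ j'
  ... | yes refl = begin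
    Δ G (vtx i j) (vtx i j)
      ≡⟨ Δ-diag G {vtx i j} refl ⟩
    - (+ deg (edges G) (just (toℕ (vtx i j))))
      ≡⟨ cong (λ v → - (+ deg (edges G) (just v))) (toℕ-vtx i j) ⟩
    - (+ deg (edges G) (just (start i + toℕ j)))
      ≡⟨ cong (λ n → - (+ n)) (length-filter-vtx (incident? _) i j (λ inc → inc)) ⟩
    - (+ deg (childEdges (just 0) (start i) (child i)) (just (start i + toℕ j)))
      ≡⟨ cong (λ n → - (+ n)) (child-deg (0<start i) (child i) (toℕ j)) ⟩
    - (+ deg (edges (bar (child i))) (just (toℕ j))) ∎
    where open ≡-Reasoning
  ... | no j≢j' = begin
    Δ G (vtx i j) (vtx i j')
      ≡⟨ Δ-offdiag G (j≢j' ∘ vtx-injectiveʳ) ⟩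
    + nEdges (edges G) (just (toℕ (vtx i j))) (just (toℕ (vtx i j')))
      ≡⟨ cong₂ (λ v v' → + nEdges (edges G) (just v) (just v')) (toℕ-vtx i j) (toℕ-vtx i j') ⟩
    + nEdges (edges G) (just (start i + toℕ j)) (just (start i + toℕ j'))
      ≡⟨ cong +_ (length-filter-vtx (joins? _ _) i j Joins⇒Incidentˡ) ⟩
    + nEdges (childEdges (just 0) (start i) (child i)) (just (start i + toℕ j)) (just (start i + toℕ j'))
      ≡⟨ cong +_ (child-nEdges (0<start i) (child i) (toℕ j) (toℕ j')) ⟩
    + nEdges (edges (bar (child i))) (just (toℕ j)) (just (toℕ j')) ∎
    where open ≡-Reasoning

  Δ-vtx-other : ∀ {i i'} → i ≢ i' → ∀ j j' → Δ G (vtx i j) (vtx i' j') ≡ + 0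
  Δ-vtx-other {i} {i'} i≢i' j j' = begin
    Δ G (vtx i j) (vtx i' j')
      ≡⟨ Δ-offdiag G (i≢i' ∘ vtx-injectiveˡ) ⟩
    + nEdges (edges G) (just (toℕ (vtx i j))) (just (toℕ (vtx i' j')))
      ≡⟨ cong₂ (λ v v' → + nEdges (edges G) (just v) (just v')) (toℕ-vtx i j) (toℕ-vtx i' j') ⟩
    + nEdges (edges G) x y
      ≡⟨ cong +_ (length-filter-edges (joins? x y) (sinkEdge-avoid i j ∘ Joins⇒Incidentˡ)) ⟩
    + ℕΣ.sum (λ i'' → nEdges (childEdges (just 0) (start i'') (child i'')) x y)
      ≡⟨ cong +_ (sum-zero ℕP.+-0-monoid _ no-joining-edge) ⟩
    + 0 ∎
    where
      open ≡-Reasoning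
      x = just (start i + toℕ j)
      y = just (start i' + toℕ j')
      no-joining-edge : ∀ i'' → nEdges (childEdges (just 0) (start i'') (child i'')) x y ≡ 0
      no-joining-edge i'' with i'' ≟ i
      ... | yes refl = nEdges-avoidʳ x (child-avoid-vtx {i'} i≢i' j')
      ... | no i''≢i = nEdges-avoidˡ y (child-avoid-vtx i''≢i j)

  δᵣ : Fin (nV G) → ℤ
  δᵣ = δ G (just 0)

  r̂ : (i : Fin k) → Fin (nInt (child i)) → ℤ
  r̂ i = rootHat (child i)

  LHS : AbelianGroup 0ℓ 0ℓ
  LHS = SP G /⟨ δᵣ ⟩

  RHS : AbelianGroup 0ℓ 0ℓ
  RHS = ⨁ k (λ i → SP (bar (child i))) /⟨ r̂ ⟩

  private
    module L = AbelianGroup LHS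
    module R = AbelianGroup RHS
    module LΣ = Algebra.Properties.Monoid.Sum L.monoid

  IsColumn : (Fin (nV G) → ℤ) → Set
  IsColumn v = Σ (Fin (nV G)) (λ m → ∀ a → v a ≡ Δ G a m)

  column≈ε : ∀ m → (λ a → Δ G a m) L.≈ L.ε
  column≈ε m = incl (gen (m , λ a → refl))

  ≈-mod-δᵣ : ∀ {x y} z → (∀ a → x a ≡ y a ℤ.+ z ℤ.* δᵣ a) → x L.≈ y
  ≈-mod-δᵣ {x} {y} z x≡y+zδᵣ =
    L.trans (incl (incl x≡y+zδᵣ)) (L.trans (L.∙-congˡ {y} (scale-≈ε (gen refl) z)) (L.identityʳ y))

  Blocks : Set
  Blocks = (i : Fin k) → Fin (nInt (child i)) → ℤ

  restrict : (Fin (nV G) → ℤ) → Blocks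
  restrict x i j = x (vtx i j)

  unblock : Blocks → Fin (nV G) → ℤ
  unblock w zero    = + 0
  unblock w (suc b) = uncurry w (locate ts b)

  unblock-≈ : ∀ {w x} → x zero ≡ + 0 → (∀ b → uncurry w (locate ts b) ≡ x (suc b)) → unblock w L.≈ x
  unblock-≈ x₀≡0 w≗x = incl (incl λ { zero → sym x₀≡0 ; (suc b) → w≗x b })

  restrict-unblock : ∀ w → restrict (unblock w) R.≈ w
  restrict-unblock w = incl (λ i → incl (λ j → cong (uncurry w) (locate-block ts i j)))

  unblock-restrict : ∀ x → unblock (restrict x) L.≈ x
  unblock-restrict x = L.sym (≈-mod-δᵣ (x zero) pointwise)
    where
      pointwise : ∀ a → x a ≡ unblock (restrict x) a ℤ.+ x zero ℤ.* δᵣ a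
      pointwise zero    = sym (trans (ℤP.+-identityˡ _) (ℤP.*-identityʳ (x zero)))
      pointwise (suc b) = begin
        x (suc b)                    ≡⟨ cong x (vtx-locate b) ⟨
        xᵇ                           ≡⟨ ℤP.+-identityʳ xᵇ ⟨
        xᵇ ℤ.+ + 0                   ≡⟨ cong (ℤ._+_ xᵇ) (ℤP.*-zeroʳ (x zero)) ⟨
        xᵇ ℤ.+ x zero ℤ.* + 0        ∎
        where
          open ≡-Reasoning
          xᵇ = unblock (restrict x) (suc b)

  restrict-column : ∀ {v} → IsColumn v → restrict v R.≈ R.ε
  restrict-column {v} (zero , v≡col) =
    R.trans (incl (λ i → incl (λ j → trans (v≡col (vtx i j)) (Δ-vtx-root i j)))) (gen refl)
  restrict-column {v} (suc b , v≡col) = incl block-column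
    where
      i' = proj₁ (locate ts b)
      j' = proj₂ (locate ts b)
      v≡col' : ∀ a → v a ≡ Δ G a (vtx i' j')
      v≡col' a = trans (v≡col a) (cong (Δ G a) (sym (vtx-locate b)))
      block-column : ∀ i → AbelianGroup._≈_ (SP (bar (child i))) (restrict v i) (λ _ → + 0)
      block-column i with i ≟ i'
      ... | yes refl = gen (j' , λ j → trans (v≡col' (vtx i j)) (Δ-vtx-vtx i j j'))
      ... | no i≢i'  = incl (λ j → trans (v≡col' (vtx i j)) (Δ-vtx-other i≢i' j j'))

  restrict-hom : IsGroupHomomorphism (rawGroup LHS) (rawGroup RHS) restrict
  restrict-hom =
    Quot-lift {SP G} {RHS} {_≡ δᵣ} (Quot-lift {ℤ^ (nV G)} {RHS} {IsColumn} pointwise-hom restrict-column)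
      λ { refl → R.refl }
    where
      pointwise-hom : IsGroupHomomorphism (rawGroup (ℤ^ (nV G))) (rawGroup RHS) restrict
      pointwise-hom = record
        { isMonoidHomomorphism = record
          { isMagmaHomomorphism = record
            { isRelHomomorphism = record { cong = λ x≗y → incl (λ i → incl (λ j → x≗y (vtx i j))) }
            ; homo = λ _ _ → R.refl }
          ; ε-homo = R.refl }
        ; ⁻¹-homo = λ _ → R.refl }

  single : (i : Fin k) → (Fin (nInt (child i)) → ℤ) → Blocks
  single i y i' with i' ≟ i
  ... | yes refl = y
  ... | no _     = λ _ → + 0

  single-diag : ∀ i y j → single i y i j ≡ y j
  single-diag i y j with i ≟ i
  ... | yes refl = refl
  ... | no i≢i   = ⊥-elim (i≢i refl)

  single-offdiag : ∀ {i i'} y j → i' ≢ i → single i y i' j ≡ + 0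
  single-offdiag {i} {i'} y j i'≢i with i' ≟ i
  ... | yes i'≡i = ⊥-elim (i'≢i i'≡i)
  ... | no _     = refl

  single-cong : ∀ i {y y'} → (∀ j → y j ≡ y' j) → ∀ i' j → single i y i' j ≡ single i y' i' j
  single-cong i y≗y' i' j with i' ≟ i
  ... | yes refl = y≗y' j
  ... | no _     = refl

  single-zipWith : ∀ (f : ℤ → ℤ → ℤ) → f (+ 0) (+ 0) ≡ + 0 →
    ∀ i y y' i' j → single i (λ j → f (y j) (y' j)) i' j ≡ f (single i y i' j) (single i y' i' j)
  single-zipWith f f00≡0 i y y' i' j with i' ≟ i
  ... | yes refl = refl
  ... | no _     = sym f00≡0

  inject : (i : Fin k) → (Fin (nInt (child i)) → ℤ) → Fin (nV G) → ℤ
  inject i y = unblock (single i y)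

  inject-hom : ∀ i → IsGroupHomomorphism (rawGroup (ℤ^ (nInt (child i)))) (rawGroup LHS) (inject i)
  inject-hom i = record
    { isMonoidHomomorphism = record
      { isMagmaHomomorphism = record
        { isRelHomomorphism = record
          { cong = λ y≗y' → unblock-≈ refl λ b → single-cong i y≗y' (i' b) (j' b) }
        ; homo = λ y y' → unblock-≈ refl λ b → single-zipWith ℤ._+_ refl i y y' (i' b) (j' b) }
      ; ε-homo = unblock-≈ refl λ b → single-zipWith (λ _ _ → + 0) refl i y₀ y₀ (i' b) (j' b) }
    ; ⁻¹-homo = λ y → unblock-≈ refl λ b → single-zipWith (λ a _ → - a) refl i y y (i' b) (j' b) }
    where
      i' = proj₁ ∘ locate ts
      j' = proj₂ ∘ locate ts
      y₀ = λ _ → + 0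

  inject-column : ∀ i {v} → Σ (Fin (nInt (child i))) (λ j' → ∀ j → v j ≡ Δ (bar (child i)) j j') →
                  inject i v L.≈ L.ε
  inject-column i {v} (j' , v≡col) = L.trans (≈-mod-δᵣ (- r̂ i j') pointwise) (column≈ε (vtx i j'))
    where
      single-column : ∀ i'' j'' → single i v i'' j'' ≡ Δ G (vtx i'' j'') (vtx i j')
      single-column i'' j'' with i'' ≟ i
      ... | yes refl = trans (v≡col j'') (sym (Δ-vtx-vtx i j'' j'))
      ... | no i''≢i = sym (Δ-vtx-other i''≢i j'' j')

      pointwise : ∀ a → inject i v a ≡ Δ G a (vtx i j') ℤ.+ (- r̂ i j') ℤ.* δᵣ a
      pointwise zero = sym (begin
        Δ G zero (vtx i j') ℤ.+ (- r̂ i j') ℤ.* + 1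
          ≡⟨ cong₂ ℤ._+_ (Δ-root-vtx i j') (ℤP.*-identityʳ (- r̂ i j')) ⟩
        r̂ i j' ℤ.+ - r̂ i j'
          ≡⟨ ℤP.+-inverseʳ (r̂ i j') ⟩
        + 0 ∎)
        where open ≡-Reasoning
      pointwise (suc b) = sym (begin
        Δ G (suc b) (vtx i j') ℤ.+ (- r̂ i j') ℤ.* + 0
          ≡⟨ cong (ℤ._+_ (Δ G (suc b) (vtx i j'))) (ℤP.*-zeroʳ (- r̂ i j')) ⟩
        Δ G (suc b) (vtx i j') ℤ.+ + 0
          ≡⟨ ℤP.+-identityʳ _ ⟩
        Δ G (suc b) (vtx i j')
          ≡⟨ cong (λ a → Δ G a (vtx i j')) (vtx-locate b) ⟨
        Δ G (vtx (proj₁ (locate ts b)) (proj₂ (locate ts b))) (vtx i j')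
          ≡⟨ single-column (proj₁ (locate ts b)) (proj₂ (locate ts b)) ⟨
        inject i v (suc b) ∎)
        where open ≡-Reasoning

  sum-apply : ∀ {m} (f : Fin m → Fin (nV G) → ℤ) a → LΣ.sum f a ≡ ℤΣ.sum (λ i → f i a)
  sum-apply {zero}  f a = refl
  sum-apply {suc m} f a = cong (ℤ._+_ (f zero a)) (sum-apply (f ∘ suc) a)

  unblock-as-sum : ∀ w a → unblock w a ≡ ℤΣ.sum (λ i → inject i (w i) a)
  unblock-as-sum w zero    = sym (sum-zero ℤP.+-0-monoid (λ i → inject i (w i) zero) (λ _ → refl))
  unblock-as-sum w (suc b) = sym (trans
    (sum-single ℤP.+-0-monoid _ i' (λ i i≢i' → single-offdiag (w i) j' (i≢i' ∘ sym)))
    (single-diag i' (w i') j'))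
    where
      i' = proj₁ (locate ts b)
      j' = proj₂ (locate ts b)

  -- The relation of ⨁ SP(T̄ⁱ) holds block by block, so unblock is compared through the sum
  -- of its single-block parts.
  unblock-hom : IsGroupHomomorphism (rawGroup (⨁ k (λ i → SP (bar (child i))))) (rawGroup LHS) unblock
  unblock-hom = record
    { isMonoidHomomorphism = record
      { isMagmaHomomorphism = record
        { isRelHomomorphism = record { cong = blockwise-cong }
        ; homo = λ _ _ → unblock-≈ refl λ _ → refl }
      ; ε-homo = unblock-≈ refl λ _ → refl }
    ; ⁻¹-homo = λ _ → unblock-≈ refl λ _ → refl }
    where
      as-sum : ∀ w → unblock w L.≈ LΣ.sum (λ i → inject i (w i))
      as-sum w = incl (incl (λ a → trans (unblock-as-sum w a) (sym (sum-apply (λ i → inject i (w i)) a))))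

      blockwise-cong : ∀ {w w'} → (∀ i → AbelianGroup._≈_ (SP (bar (child i))) (w i) (w' i)) →
                       unblock w L.≈ unblock w'
      blockwise-cong {w} {w'} w≈w' = L.trans (as-sum w) (L.trans
        (LΣ.sum-cong-≋ (λ i → Quot-lift-cong {H = LHS} (inject-hom i) (inject-column i) (w≈w' i)))
        (L.sym (as-sum w')))

  unblock-r̂ : unblock r̂ L.≈ L.ε
  unblock-r̂ = L.trans (≈-mod-δᵣ (+ suc k) pointwise) (column≈ε zero)
    where
      pointwise : ∀ a → unblock r̂ a ≡ Δ G a zero ℤ.+ + suc k ℤ.* δᵣ a
      pointwise zero = sym (begin
        Δ G zero zero ℤ.+ + suc k ℤ.* + 1 ≡⟨ cong₂ ℤ._+_ Δ-root-root (ℤP.*-identityʳ (+ suc k)) ⟩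
        - (+ suc k) ℤ.+ + suc k           ≡⟨ ℤP.+-inverseˡ (+ suc k) ⟩
        + 0 ∎)
        where open ≡-Reasoning
      pointwise (suc b) = sym (begin
        Δ G (suc b) zero ℤ.+ + suc k ℤ.* + 0
          ≡⟨ cong (ℤ._+_ (Δ G (suc b) zero)) (ℤP.*-zeroʳ (+ suc k)) ⟩
        Δ G (suc b) zero ℤ.+ + 0
          ≡⟨ ℤP.+-identityʳ _ ⟩
        Δ G (suc b) zero
          ≡⟨ cong (λ a → Δ G a zero) (vtx-locate b) ⟨
        Δ G (vtx (proj₁ (locate ts b)) (proj₂ (locate ts b))) zero
          ≡⟨ Δ-vtx-root (proj₁ (locate ts b)) (proj₂ (locate ts b)) ⟩
        unblock r̂ (suc b) ∎)
        where open ≡-Reasoning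

  unblock-cong : ∀ {w w'} → w R.≈ w' → unblock w L.≈ unblock w'
  unblock-cong =
    Quot-lift-cong {⨁ k (λ i → SP (bar (child i)))} {LHS} {_≡ r̂} unblock-hom λ { refl → unblock-r̂ }

  iso : LHS ≅ RHS
  iso = inverse⇒≅ {LHS} {RHS} restrict-hom unblock-cong restrict-unblock unblock-restrict

theorem3p4 : (ts : List Tree) →
    (SP (bar (node ts)) /⟨ rootHat (node ts) ⟩)
      ≅ (⨁ (length ts) (λ i → SP (bar (lookup ts i))) /⟨ (λ i → rootHat (lookup ts i)) ⟩)
theorem3p4 []         =
  trivial-≅ {SP (bar (node [])) /⟨ rootHat (node []) ⟩}
            {⨁ 0 (λ i → SP (bar (lookup [] i))) /⟨ (λ i → rootHat (lookup [] i)) ⟩}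
            (λ _ _ → incl (incl λ ())) (λ _ _ → incl λ ())
theorem3p4 ts@(_ ∷ _) = BarNode.iso ts
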